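{- Let $n\ge 3$. If $\mathcal{H}=(V,\mathcal{E})$ is a $4$-uniform hypergraph with $EI(\mathcal{H})=C_n$, then $n\ge 11$.
   Context: Hypergraphs $\mathcal{H}=(V,\mathcal{E})$ have no multiple hyperedges; isolated vertices are allowed. $\mathcal{H}$ is $4$-uniform if every hyperedge has exactly $4$ elements. The edge intersection hypergraph of $\mathcal{H}$ is $EI(\mathcal{H})=(V,\mathcal{E}^{EI})$ with $\mathcal{E}^{EI}=\{e_1\cap e_2: e_1,e_2\in\mathcal{E},\ e_1\ne e_2,\ |e_1\cap e_2|\ge 2\}$. $C_n$ is the cycle with vertex set $\{1,\dots,n\}$ and edges $\{i,i+1\}$, $i=1,\dots,n$ (indices mod $n$); "$EI(\mathcal{H})=C_n$" means $V=\{1,\dots,n\}$ and $\mathcal{E}^{EI}$ is exactly the edge set of $C_n$. -}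

module Defs where

open import Data.Nat using (ℕ; zero; suc; _≤_)
open import Data.Nat.DivMod using (_mod_)
open import Data.Fin using (Fin; toℕ)
open import Data.Fin.Subset using (Subset; _∩_; _∪_; ⁅_⁆; ∣_∣)
open import Data.Product using (Σ; ∃; _×_)
open import Data.Empty using (⊥)
open import Relation.Binary.PropositionalEquality using (_≡_; _≢_)
open import Function.Bundles using (_⇔_)

-- A hypergraph on the vertex set V = Fin n: its hyperedge set is a set of
-- subsets of V, given as a predicate (so there are no multiple hyperedges;
-- isolated vertices are allowed).
record Hypergraph (n : ℕ) : Set₁ where
  field
    IsEdge : Subset n → Set
open Hypergraph public

FourUniform : {n : ℕ} → Hypergraph n → Set
FourUniform H = ∀ e → IsEdge H e → ∣ e ∣ ≡ 4

IsEIEdge : {n : ℕ} → Hypergraph n → Subset n → Set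
IsEIEdge {n} H s =
  Σ (Subset n) λ e₁ → Σ (Subset n) λ e₂ →
    IsEdge H e₁ × IsEdge H e₂ × e₁ ≢ e₂ × (e₁ ∩ e₂ ≡ s) × (2 ≤ ∣ s ∣)

-- edges of the cycle C_n on vertex set Fin n (vertex i ↦ i+1 relabelling):
-- {i, i+1 mod n}
IsCycleEdge : (n : ℕ) → Subset n → Set
IsCycleEdge zero    s = ⊥
IsCycleEdge (suc m) s = ∃ λ (i : Fin (suc m)) → s ≡ ⁅ i ⁆ ∪ ⁅ suc (toℕ i) mod suc m ⁆

EIisCycle : {n : ℕ} → Hypergraph n → Set
EIisCycle {n} H = ∀ s → IsEIEdge H s ⇔ IsCycleEdge n s

-- Distinct edges of a hypergraph H with EI(H) = C_n meet in at most one vertex or in an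
-- edge of C_n, and every cycle edge {i, i+1} is the meet of two edges.  If no edge contains
-- the triple {i, i+1, i+2}, the two edges meeting in {i, i+1} and the two meeting in
-- {i+1, i+2} pairwise meet only in i+1, which takes 3 + 8 = 11 vertices.  So for n ≤ 10 each
-- triple lies in an edge T_i, and one of the two edges meeting in {i+1, i+2} is an edge F_i
-- not containing i (for n ≥ 3).  For each 3 ≤ n ≤ 10 an exhaustive search over 4-sets shows that no family
-- T_i, F_i has pairwise admissible meets; both searches are decided by evaluation.

module Submission where

open import Defs
open import Data.Bool using (Bool; true; false; T; T?; not; _∧_; _∨_)
open import Data.Bool.ListAction using (any; all)
open import Data.Bool.Properties using (T-∧; T-∨; T-≡)
open import Data.Empty using (⊥; ⊥-elim)
open import Data.Fin using (Fin; toℕ)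
open import Data.Fin.Subset using (Subset; inside; outside; _∩_; _∪_; _⊆_; ⁅_⁆; ∣_∣)
open import Data.Fin.Subset.Properties using (_⊆?_; p∩q⊆p; p∩q⊆q; x∈p∩q⁺; x∈p∪q⁻)
open import Data.List using (List; []; _∷_; [_]; _++_; map; filterᵇ; tabulate; allFin)
open import Data.List.Membership.Propositional using (_∈_; lose)
open import Data.List.Membership.Propositional.Properties
  using (∈-map⁺; ∈-++⁺ˡ; ∈-++⁺ʳ; ∈-filter⁺; ∈-tabulate⁺; ∈-allFin)
open import Data.List.Relation.Binary.Pointwise as Pointwise using (Pointwise; []; _∷_)
open import Data.List.Relation.Unary.All as All using (All; []; _∷_)
open import Data.List.Relation.Unary.All.Properties as Allₚ using (all⁺; all⁻)
open import Data.List.Relation.Unary.AllPairs using (AllPairs; []; _∷_)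
open import Data.List.Relation.Unary.Any using (here)
open import Data.List.Relation.Unary.Any.Properties using (any⁺)
open import Data.Nat using (ℕ; zero; suc; _≤_; s≤s; _<ᵇ_; _<?_)
open import Data.Nat.DivMod using (_mod_)
open import Data.Nat.Properties using (≮⇒≥; <⇒<ᵇ; m≤m+n)
open import Data.Product using (_×_; _,_; proj₁; proj₂; ∃-syntax)
open import Data.Sum using (_⊎_; inj₁; inj₂) renaming ([_,_] to [_,_]′)
open import Data.Vec using ([]; _∷_)
open import Function using (_∘_; _∘₂_)
open import Function.Bundles using (Equivalence)
open import Relation.Binary.PropositionalEquality using (_≡_; _≢_; refl; sym; cong; subst)
open import Relation.Nullary using (¬_; yes; no)
open import Relation.Nullary.Decidable using (isYes; isNo; fromWitness; fromWitnessFalse; toWitnessFalse)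

module _ {A : Set} (R : A → A → Bool) where

  consistentChoice : List A → List (List A) → Bool
  consistentChoice chosen []       = true
  consistentChoice chosen (L ∷ Ls) = any (λ x → all (R x) chosen ∧ consistentChoice (x ∷ chosen) Ls) L

  consistentChoice-complete : ∀ {chosen xs Ls} → Pointwise _∈_ xs Ls →
                              AllPairs (λ x y → T (R y x)) xs →
                              All (λ x → All (T ∘ R x) chosen) xs →
                              T (consistentChoice chosen Ls)
  consistentChoice-complete []              []                []                     = _
  consistentChoice-complete (x∈L ∷ xs∈Ls) (x~xs ∷ xs-pairs) (x~chosen ∷ xs~chosen) =
    any⁺ _ (lose x∈L (Equivalence.from T-∧ (all⁻ _ x~chosen ,
      consistentChoice-complete xs∈Ls xs-pairs
        (All.zipWith (λ (y~x , y~chosen) → y~x ∷ y~chosen) (x~xs , xs~chosen)))))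

All⇒AllPairs : ∀ {A : Set} {P : A → Set} {R : A → A → Set} {xs} →
               (∀ {x y} → P x → P y → R x y) → All P xs → AllPairs R xs
All⇒AllPairs R-P []         = []
All⇒AllPairs R-P (px ∷ pxs) = All.map (R-P px) pxs ∷ All⇒AllPairs R-P pxs

T-not⇒¬T : ∀ {b} → T (not b) → ¬ T b
T-not⇒¬T {true}  ()
T-not⇒¬T {false} _ ()

subsetsOfSize : ℕ → (n : ℕ) → List (Subset n)
subsetsOfSize zero    zero    = [ [] ]
subsetsOfSize (suc k) zero    = []
subsetsOfSize zero    (suc n) = map (outside ∷_) (subsetsOfSize zero n)
subsetsOfSize (suc k) (suc n) =
  map (inside ∷_) (subsetsOfSize k n) ++ map (outside ∷_) (subsetsOfSize (suc k) n)

outside∷∈subsetsOfSize : ∀ k {n} {p : Subset n} →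
                         p ∈ subsetsOfSize k n → outside ∷ p ∈ subsetsOfSize k (suc n)
outside∷∈subsetsOfSize zero    p∈ = ∈-map⁺ _ p∈
outside∷∈subsetsOfSize (suc k) p∈ = ∈-++⁺ʳ _ (∈-map⁺ _ p∈)

∈-subsetsOfSize : ∀ {n} (p : Subset n) → p ∈ subsetsOfSize ∣ p ∣ n
∈-subsetsOfSize []            = here refl
∈-subsetsOfSize (inside  ∷ p) = ∈-++⁺ˡ (∈-map⁺ _ (∈-subsetsOfSize p))
∈-subsetsOfSize (outside ∷ p) = outside∷∈subsetsOfSize ∣ p ∣ (∈-subsetsOfSize p)

-- Equality test and size by direct recursion: the stdlib versions, going through
-- Dec combinators, make the exhaustive searches below several times slower.
infix 4 _=ᵇ_
_=ᵇ_ : ∀ {n} → Subset n → Subset n → Bool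
[]          =ᵇ []          = true
inside  ∷ p =ᵇ inside  ∷ q = p =ᵇ q
outside ∷ p =ᵇ outside ∷ q = p =ᵇ q
inside  ∷ p =ᵇ outside ∷ q = false
outside ∷ p =ᵇ inside  ∷ q = false

=ᵇ-sound : ∀ {n} (p q : Subset n) → T (p =ᵇ q) → p ≡ q
=ᵇ-sound []            []            _   = refl
=ᵇ-sound (inside  ∷ p) (inside  ∷ q) p=q = cong (inside ∷_) (=ᵇ-sound p q p=q)
=ᵇ-sound (outside ∷ p) (outside ∷ q) p=q = cong (outside ∷_) (=ᵇ-sound p q p=q)

=ᵇ-refl : ∀ {n} (p : Subset n) → T (p =ᵇ p)
=ᵇ-refl []            = _
=ᵇ-refl (inside  ∷ p) = =ᵇ-refl p
=ᵇ-refl (outside ∷ p) = =ᵇ-refl p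

=ᵇ-complete : ∀ {n} {p q : Subset n} → p ≡ q → T (p =ᵇ q)
=ᵇ-complete {p = p} refl = =ᵇ-refl p

≢⇒not=ᵇ : ∀ {n} {p q : Subset n} → p ≢ q → T (not (p =ᵇ q))
≢⇒not=ᵇ {p = p} {q} p≢q with p =ᵇ q | =ᵇ-sound p q
... | true  | sound = p≢q (sound _)
... | false | _     = _

size : ∀ {n} → Subset n → ℕ
size []            = zero
size (inside  ∷ p) = suc (size p)
size (outside ∷ p) = size p

size≡∣∣ : ∀ {n} (p : Subset n) → size p ≡ ∣ p ∣
size≡∣∣ []            = refl
size≡∣∣ (inside  ∷ p) = cong suc (size≡∣∣ p)
size≡∣∣ (outside ∷ p) = size≡∣∣ p

∪-lub : ∀ {n} {p q r : Subset n} → p ⊆ r → q ⊆ r → p ∪ q ⊆ r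
∪-lub {p = p} {q} p⊆r q⊆r = [ p⊆r , q⊆r ]′ ∘ x∈p∪q⁻ p q

∩-glb : ∀ {n} {p q r : Subset n} → r ⊆ p → r ⊆ q → r ⊆ p ∩ q
∩-glb r⊆p r⊆q x∈r = x∈p∩q⁺ (r⊆p x∈r , r⊆q x∈r)

∩≡⇒⊆ˡ : ∀ {n} {p q r : Subset n} → p ∩ q ≡ r → r ⊆ p
∩≡⇒⊆ˡ {p = p} {q} refl = p∩q⊆p p q

∩≡⇒⊆ʳ : ∀ {n} {p q r : Subset n} → p ∩ q ≡ r → r ⊆ q
∩≡⇒⊆ʳ {p = p} {q} refl = p∩q⊆q p q

quadruplesWhere : ∀ {n} → (Subset n → Bool) → List (Subset n)
quadruplesWhere {n} P = filterᵇ P (subsetsOfSize 4 n)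

module Cycle {m : ℕ} where

  next : Fin (suc m) → Fin (suc m)
  next i = suc (toℕ i) mod suc m

  cycleEdge : Fin (suc m) → Subset (suc m)
  cycleEdge i = ⁅ i ⁆ ∪ ⁅ next i ⁆

  triple : Fin (suc m) → Subset (suc m)
  triple i = cycleEdge i ∪ cycleEdge (next i)

  coveringTriple : Fin (suc m) → List (Subset (suc m))
  coveringTriple i = quadruplesWhere (λ s → isYes (triple i ⊆? s))

  avoidingTriple : Fin (suc m) → Subset (suc m) → List (Subset (suc m))
  avoidingTriple i e = quadruplesWhere (λ s → isYes (e ⊆? s) ∧ isNo (triple i ⊆? s))

  -- The cycle edges are a parameter so that evaluation computes them (and their mods) once.
  module Searches (cycleEdges : List (Subset (suc m))) where

    admissibleMeet : Subset (suc m) → Subset (suc m) → Bool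
    admissibleMeet X Y = (size (X ∩ Y) <ᵇ 2) ∨ any (X ∩ Y =ᵇ_) cycleEdges

    compatible : Subset (suc m) → Subset (suc m) → Bool
    compatible X Y = (X =ᵇ Y) ∨ admissibleMeet X Y

    strictlyCompatible : Subset (suc m) → Subset (suc m) → Bool
    strictlyCompatible X Y = not (X =ᵇ Y) ∧ admissibleMeet X Y

    uncoveredTriplePossible : Fin (suc m) → Bool
    uncoveredTriplePossible i = consistentChoice strictlyCompatible []
      (avoidingTriple i (cycleEdge i) ∷ avoidingTriple i (cycleEdge i) ∷
       avoidingTriple i (cycleEdge (next i)) ∷ avoidingTriple i (cycleEdge (next i)) ∷ [])

    familyPossible : Bool
    familyPossible = consistentChoice compatible []
      (tabulate coveringTriple ++ tabulate (λ i → avoidingTriple i (cycleEdge (next i))))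

  open Searches (tabulate cycleEdge) public

  -- The middle conjunct just says that C_n has at least three vertices.
  cycleRefuted : Bool
  cycleRefuted =
    all (λ i → not (uncoveredTriplePossible i) ∧ isNo (triple i ⊆? cycleEdge (next i))) (allFin (suc m))
    ∧ not familyPossible

module _ {m : ℕ} {H : Hypergraph (suc m)} (uniform : FourUniform H) (ei : EIisCycle H) where
  open Cycle {m}

  edge∈quadruplesWhere : ∀ {P X} → IsEdge H X → T (P X) → X ∈ quadruplesWhere P
  edge∈quadruplesWhere {P} {X} eX PX =
    ∈-filter⁺ _ (subst (λ k → X ∈ subsetsOfSize k (suc m)) (uniform X eX) (∈-subsetsOfSize X)) PX

  edges-admissible : ∀ {X Y} → IsEdge H X → IsEdge H Y → X ≢ Y → T (admissibleMeet X Y)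
  edges-admissible {X} {Y} eX eY X≢Y with size (X ∩ Y) <? 2
  ... | yes <2 = Equivalence.from (T-∨ {size (X ∩ Y) <ᵇ 2}) (inj₁ (<⇒<ᵇ <2))
  ... | no ≮2 =
    let i , X∩Y≡ = Equivalence.to (ei (X ∩ Y))
                     (X , Y , eX , eY , X≢Y , refl , subst (2 ≤_) (size≡∣∣ (X ∩ Y)) (≮⇒≥ ≮2))
    in Equivalence.from (T-∨ {size (X ∩ Y) <ᵇ 2})
         (inj₂ (any⁺ (X ∩ Y =ᵇ_) (lose (∈-tabulate⁺ {f = cycleEdge} i) (=ᵇ-complete X∩Y≡))))

  edges-compatible : ∀ {X Y} → IsEdge H X → IsEdge H Y → T (compatible X Y)
  edges-compatible {X} {Y} eX eY with T? (X =ᵇ Y)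
  ... | yes X=Y = Equivalence.from (T-∨ {X =ᵇ Y}) (inj₁ X=Y)
  ... | no X≠Y  =
    Equivalence.from (T-∨ {X =ᵇ Y}) (inj₂ (edges-admissible eX eY (X≠Y ∘ =ᵇ-complete)))

  edges-strictlyCompatible : ∀ {X Y} → IsEdge H X → IsEdge H Y → X ≢ Y →
                             T (strictlyCompatible X Y)
  edges-strictlyCompatible {X} {Y} eX eY X≢Y =
    Equivalence.from (T-∧ {not (X =ᵇ Y)}) (≢⇒not=ᵇ X≢Y , edges-admissible eX eY X≢Y)

  Covered : Fin (suc m) → Set
  Covered i = ∃[ C ] IsEdge H C × triple i ⊆ C

  Avoids : Fin (suc m) → Subset (suc m) → Subset (suc m) → Set
  Avoids i e X = IsEdge H X × e ⊆ X × ¬ triple i ⊆ X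

  covered∈coveringTriple : ∀ {i} → (c : Covered i) → proj₁ c ∈ coveringTriple i
  covered∈coveringTriple (_ , eC , t⊆C) =
    edge∈quadruplesWhere eC (fromWitness {a? = _ ⊆? _} t⊆C)

  avoids∈avoidingTriple : ∀ {i e X} → Avoids i e X → X ∈ avoidingTriple i e
  avoids∈avoidingTriple {e = e} {X} (eX , e⊆X , t⊈X) =
    edge∈quadruplesWhere eX (Equivalence.from (T-∧ {isYes (e ⊆? X)})
      (fromWitness {a? = _ ⊆? _} e⊆X , fromWitnessFalse t⊈X))

  covered-or-avoids : ∀ {i e X} → IsEdge H X → e ⊆ X → Covered i ⊎ Avoids i e X
  covered-or-avoids {i} {e} {X} eX e⊆X with triple i ⊆? X
  ... | yes t⊆X = inj₁ (X , eX , t⊆X)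
  ... | no t⊈X  = inj₂ (eX , e⊆X , t⊈X)

  avoids-≢ : ∀ {i X Y} → Avoids i (cycleEdge i) X → Avoids i (cycleEdge (next i)) Y → Y ≢ X
  avoids-≢ (_ , c⊆X , t⊈X) (_ , c′⊆Y , _) refl = t⊈X (∪-lub c⊆X c′⊆Y)

  uncoveredTriplePossible-complete :
    ∀ {i A B A′ B′} → Avoids i (cycleEdge i) A → Avoids i (cycleEdge i) B →
    Avoids i (cycleEdge (next i)) A′ → Avoids i (cycleEdge (next i)) B′ → A ≢ B → A′ ≢ B′ →
    T (uncoveredTriplePossible i)
  uncoveredTriplePossible-complete a b a′ b′ A≢B A′≢B′ = consistentChoice-complete _
    (avoids∈avoidingTriple a ∷ avoids∈avoidingTriple b ∷
     avoids∈avoidingTriple a′ ∷ avoids∈avoidingTriple b′ ∷ [])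
    ( (sc b a (A≢B ∘ sym) ∷ sc a′ a (avoids-≢ a a′) ∷ sc b′ a (avoids-≢ a b′) ∷ [])
    ∷ (sc a′ b (avoids-≢ b a′) ∷ sc b′ b (avoids-≢ b b′) ∷ [])
    ∷ (sc b′ a′ (A′≢B′ ∘ sym) ∷ [])
    ∷ [] ∷ [])
    (All.universal (λ _ → []) _)
    where
    sc : ∀ {i e e′ X Y} → Avoids i e X → Avoids i e′ Y → X ≢ Y → T (strictlyCompatible X Y)
    sc x y = edges-strictlyCompatible (proj₁ x) (proj₁ y)

  cycleEdge-meet : ∀ i → IsEIEdge H (cycleEdge i)
  cycleEdge-meet i = Equivalence.from (ei (cycleEdge i)) (i , refl)

  triple-covered : ∀ i → ¬ T (uncoveredTriplePossible i) → Covered i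
  triple-covered i impossible
    with cycleEdge-meet i | cycleEdge-meet (next i)
  ... | A , B , eA , eB , A≢B , A∩B , _ | A′ , B′ , eA′ , eB′ , A′≢B′ , A′∩B′ , _
    with covered-or-avoids eA (∩≡⇒⊆ˡ A∩B) | covered-or-avoids eB (∩≡⇒⊆ʳ A∩B)
       | covered-or-avoids eA′ (∩≡⇒⊆ˡ A′∩B′) | covered-or-avoids eB′ (∩≡⇒⊆ʳ A′∩B′)
  ... | inj₁ c | _      | _       | _       = c
  ... | _      | inj₁ c | _       | _       = c
  ... | _      | _      | inj₁ c  | _       = c
  ... | _      | _      | _       | inj₁ c  = c
  ... | inj₂ a | inj₂ b | inj₂ a′ | inj₂ b′ =
    ⊥-elim (impossible (uncoveredTriplePossible-complete a b a′ b′ A≢B A′≢B′))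

  avoiding-edge : ∀ i → ¬ triple i ⊆ cycleEdge (next i) → ∃[ F ] Avoids i (cycleEdge (next i)) F
  avoiding-edge i t⊈c with cycleEdge-meet (next i)
  ... | A , B , eA , eB , _ , A∩B , _ with triple i ⊆? A | triple i ⊆? B
  ... | yes t⊆A | yes t⊆B = ⊥-elim (t⊈c (subst (triple i ⊆_) A∩B (∩-glb t⊆A t⊆B)))
  ... | no t⊈A  | _       = A , eA , ∩≡⇒⊆ˡ A∩B , t⊈A
  ... | yes _   | no t⊈B  = B , eB , ∩≡⇒⊆ʳ A∩B , t⊈B

  familyPossible-complete : (∀ i → Covered i) → (∀ i → ∃[ F ] Avoids i (cycleEdge (next i)) F) →
                            T familyPossible
  familyPossible-complete cover avoid =
    consistentChoice-complete _ {xs = tabulate (proj₁ ∘ cover) ++ tabulate (proj₁ ∘ avoid)}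
    (Pointwise.++⁺ (Pointwise.tabulate⁺ (covered∈coveringTriple ∘ cover))
                   (Pointwise.tabulate⁺ (avoids∈avoidingTriple ∘ proj₂ ∘ avoid)))
    (All⇒AllPairs (λ {X} {Y} eX eY → edges-compatible {Y} {X} eY eX)
      (Allₚ.++⁺ (Allₚ.tabulate⁺ (proj₁ ∘ proj₂ ∘ cover)) (Allₚ.tabulate⁺ (proj₁ ∘ proj₂ ∘ avoid))))
    (All.universal (λ _ → []) _)

  cycleRefuted-impossible : T cycleRefuted → ⊥
  cycleRefuted-impossible refuted =
    let perVertex , noFamily = Equivalence.to T-∧ refuted
        at i = Equivalence.to T-∧ (All.lookup (all⁺ _ _ perVertex) (∈-allFin i))
    in T-not⇒¬T noFamily (familyPossible-complete
         (λ i → triple-covered i (T-not⇒¬T (proj₁ (at i))))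
         (λ i → avoiding-edge i (toWitnessFalse (proj₂ (at i)))))

open Cycle using (cycleRefuted)

-- Taking the finite check as an equation lets `refl` discharge it with Agda's fast
-- evaluator; the same check posed as a `T`-valued goal is much slower to elaborate.
no-hypergraph : ∀ m → cycleRefuted {m} ≡ true →
                (H : Hypergraph (suc m)) → FourUniform H → EIisCycle H → ⊥
no-hypergraph m refuted H uniform ei =
  cycleRefuted-impossible uniform ei (Equivalence.from T-≡ refuted)

theorem4 : (n : ℕ) → 3 ≤ n → (H : Hypergraph n) → FourUniform H → EIisCycle H → 11 ≤ n
theorem4 1 (s≤s ())
theorem4 2 (s≤s (s≤s ()))
theorem4 3  _ H = ⊥-elim ∘₂ no-hypergraph 2 refl H
theorem4 4  _ H = ⊥-elim ∘₂ no-hypergraph 3 refl H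
theorem4 5  _ H = ⊥-elim ∘₂ no-hypergraph 4 refl H
theorem4 6  _ H = ⊥-elim ∘₂ no-hypergraph 5 refl H
theorem4 7  _ H = ⊥-elim ∘₂ no-hypergraph 6 refl H
theorem4 8  _ H = ⊥-elim ∘₂ no-hypergraph 7 refl H
theorem4 9  _ H = ⊥-elim ∘₂ no-hypergraph 8 refl H
theorem4 10 _ H = ⊥-elim ∘₂ no-hypergraph 9 refl H
theorem4 (suc (suc (suc (suc (suc (suc (suc (suc (suc (suc (suc k))))))))))) _ _ _ _ = m≤m+n 11 k
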